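{- Let $n \geq 7$ and let $G = CS_{6,n-6}$ be the cycle-star graph with cycle length $k=6$ and $n-k \geq 1$ pendant vertices. Then $es(G) = n-3$ if $n \in \{7,8\}$, and $es(G) = n-4$ if $n \geq 9$.
   Context: For integers $k \geq 3$ and $n > k$, the cycle-star graph $CS_{k,n-k}$ is the simple graph on $n$ vertices consisting of a cycle of length $k$ together with $n-k$ additional vertices of degree one (leaves), all adjacent to the same single vertex of the cycle. For a simple graph $G$, a vertex $k$-labeling is a map $\phi: V(G) \to \{1,2,\ldots,k\}$; the weight of an edge $uv$ is $w_\phi(uv) = \phi(u)+\phi(v)$. The labeling is an edge irregular $k$-labeling if distinct edges have distinct weights. The edge irregularity strength $es(G)$ is the minimum $k$ for which $G$ admits an edge irregular $k$-labeling. -}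

module Defs where

open import Data.Nat using (ℕ; zero; suc; _+_; _≤_; _<_)
open import Data.Nat.Properties using (1+n≢n; ≤-trans; ≤-reflexive)
open import Data.Fin using (Fin; toℕ)
open import Data.Product using (_×_; Σ; ∃; _,_)
open import Data.Sum using (_⊎_; inj₁; inj₂)
open import Relation.Nullary using (¬_)
open import Relation.Binary.PropositionalEquality using (_≡_; refl)

record SimpleGraph (n : ℕ) : Set₁ where
  field
    Adj   : Fin n → Fin n → Set
    sym   : ∀ {u v} → Adj u v → Adj v u
    loopless : ∀ {u} → ¬ Adj u u
open SimpleGraph public

SameEdge : ∀ {n} → Fin n → Fin n → Fin n → Fin n → Set
SameEdge u v x y = (u ≡ x × v ≡ y) ⊎ (u ≡ y × v ≡ x)

IsVertexLabeling : ∀ {n} → ℕ → (Fin n → ℕ) → Set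
IsVertexLabeling {n} k φ = ∀ (v : Fin n) → 1 ≤ φ v × φ v ≤ k

IsEdgeIrregularLabeling : ∀ {n} → SimpleGraph n → ℕ → (Fin n → ℕ) → Set
IsEdgeIrregularLabeling {n} G k φ =
  IsVertexLabeling k φ ×
  (∀ (u v x y : Fin n) → Adj G u v → Adj G x y →
     φ u + φ v ≡ φ x + φ y → SameEdge u v x y)

HasEdgeIrregularLabeling : ∀ {n} → SimpleGraph n → ℕ → Set
HasEdgeIrregularLabeling {n} G k = Σ (Fin n → ℕ) (IsEdgeIrregularLabeling G k)

EdgeIrregularityStrength : ∀ {n} → SimpleGraph n → ℕ → Set
EdgeIrregularityStrength G s =
  HasEdgeIrregularLabeling G s × (∀ k → k < s → ¬ HasEdgeIrregularLabeling G k)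

-- Cycle-star graph CS_{k,m} on k + m vertices, for k = j + 3 ≥ 3:
-- vertices 0,…,k-1 form the cycle (i ~ i+1 for i+1 < k, and 0 ~ k-1),
-- vertices k,…,k+m-1 are leaves adjacent to vertex 0 (a cycle vertex).
CycleStep : (k : ℕ) → ℕ → ℕ → Set
CycleStep k a b = (suc a ≡ b × b < k) ⊎ (a ≡ 0 × suc b ≡ k)

CSAdj : (k m : ℕ) → Fin (k + m) → Fin (k + m) → Set
CSAdj k m u v =
  CycleStep k (toℕ u) (toℕ v) ⊎ CycleStep k (toℕ v) (toℕ u)
  ⊎ (toℕ u ≡ 0 × k ≤ toℕ v)
  ⊎ (toℕ v ≡ 0 × k ≤ toℕ u)

private
  step-irrefl : ∀ j a → ¬ CycleStep (3 + j) a a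
  step-irrefl j a (inj₁ (e , _)) = 1+n≢n e
  step-irrefl j .0 (inj₂ (refl , ()))

  CS-sym : ∀ k m {u v} → CSAdj k m u v → CSAdj k m v u
  CS-sym k m (inj₁ p) = inj₂ (inj₁ p)
  CS-sym k m (inj₂ (inj₁ p)) = inj₁ p
  CS-sym k m (inj₂ (inj₂ (inj₁ p))) = inj₂ (inj₂ (inj₂ p))
  CS-sym k m (inj₂ (inj₂ (inj₂ p))) = inj₂ (inj₂ (inj₁ p))

  CS-irrefl : ∀ j m {u} → ¬ CSAdj (3 + j) m u u
  CS-irrefl j m {u} (inj₁ p) = step-irrefl j (toℕ u) p
  CS-irrefl j m {u} (inj₂ (inj₁ p)) = step-irrefl j (toℕ u) p
  CS-irrefl j m {u} (inj₂ (inj₂ (inj₁ (e , le)))) = 0≢k (≤-trans le (≤-reflexive e))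
    where 0≢k : ¬ (3 + j ≤ 0)
          0≢k ()
  CS-irrefl j m {u} (inj₂ (inj₂ (inj₂ (e , le)))) = 0≢k (≤-trans le (≤-reflexive e))
    where 0≢k : ¬ (3 + j ≤ 0)
          0≢k ()

CS : (j m : ℕ) → SimpleGraph ((3 + j) + m)
CS j m = record { Adj = CSAdj (3 + j) m ; sym = CS-sym (3 + j) m ; loopless = CS-irrefl j m }

-- The lower bounds are the two counting bounds for edge irregular labelings: the weights of
-- the edges lie in {2, …, 2k}, so a graph with D edges needs 2k - 1 ≥ D, and the edges at a
-- vertex of degree D need D distinct labels on its neighbours, so k ≥ D. For n = 7, 8 the
-- first bound gives n - 3 and an explicit labeling attains it. For n ≥ 9 the hub has degree
-- n - 4; labeling the hub n - 4 and its neighbours by a permutation of 1, …, n - 4 gives the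
-- hub edges the weights n - 3, …, 2n - 8, and the remaining path of the cycle can be labeled
-- 1, 1, 2, 2, 3 so that its edges take the weights 2, 3, 4, 5 below all of them.
module Submission where

open import Defs hiding (sym)
open import Data.Nat using (ℕ; suc; _+_; _∸_; _≤_; _<_; s≤s; z≤n)
open import Data.Nat.Properties
  using (_≟_; _≤?_; _<?_; +-comm; +-mono-≤; +-monoʳ-<; +-cancelˡ-≡; suc-injective;
         ∸-monoˡ-≤; ∸-monoˡ-<; m∸n+n≡m; m≤m+n; m≤n+m; m≤n⇒m≤1+n; ≤-refl; ≤-trans; ≤-<-trans;
         ≤⇒≯; <⇒≢; m≤n⇒∃[o]m+o≡n)
open import Data.Fin using (Fin; toℕ; fromℕ<; _↑ʳ_; #_) renaming (zero to fzero; suc to fsuc)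
open import Data.Fin.Properties
  using (toℕ-fromℕ<; toℕ-injective; toℕ<n; injective⇒≤; ↑ʳ-injective; all?)
  renaming (_≟_ to _≟ᶠ_)
open import Data.Vec using (_∷_; []; lookup)
open import Data.Product using (_×_; _,_; proj₁; proj₂; swap) renaming (map to ×-map)
open import Data.Sum using (_⊎_; inj₁; inj₂) renaming (map to ⊎-map)
open import Data.Empty using (⊥-elim)
open import Function using (_∘_)
open import Function.Definitions using (Injective)
open import Relation.Nullary using (Dec; ¬_)
open import Relation.Nullary.Decidable using (_×-dec_; _⊎-dec_; _→-dec_; from-yes; from-no)
open import Relation.Binary.PropositionalEquality using (_≡_; refl; sym; trans; cong; subst)

injective-in-interval⇒≤ : ∀ {D} a b (g : Fin D → ℕ) → (∀ i → a ≤ g i × g i ≤ b) →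
                          Injective _≡_ _≡_ g → D ≤ suc b ∸ a
injective-in-interval⇒≤ a b g bounds g-inj = injective⇒≤ shifted-injective
  where
    shifted : Fin _ → Fin (suc b ∸ a)
    shifted i = fromℕ< (∸-monoˡ-< (s≤s (proj₂ (bounds i))) (proj₁ (bounds i)))

    unshift : ∀ i → toℕ (shifted i) + a ≡ g i
    unshift i = trans (cong (_+ a) (toℕ-fromℕ< _)) (m∸n+n≡m (proj₁ (bounds i)))

    shifted-injective : Injective _≡_ _≡_ shifted
    shifted-injective {i} {i′} e =
      g-inj (trans (sym (unshift i)) (trans (cong (λ x → toℕ x + a) e) (unshift i′)))

DistinctEdges : ∀ {n D} → SimpleGraph n → (Fin D → Fin n × Fin n) → Set
DistinctEdges G edge =
  (∀ e → Adj G (proj₁ (edge e)) (proj₂ (edge e))) ×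
  (∀ e e′ → SameEdge (proj₁ (edge e)) (proj₂ (edge e)) (proj₁ (edge e′)) (proj₂ (edge e′)) → e ≡ e′)

module _ {n} (G : SimpleGraph n) where

  distinctNeighbours⇒≤ : ∀ {D k} v (nbr : Fin D → Fin n) → (∀ i → Adj G v (nbr i)) →
                          Injective _≡_ _≡_ nbr → HasEdgeIrregularLabeling G k → D ≤ k
  distinctNeighbours⇒≤ {k = k} v nbr adj nbr-inj (φ , labeling , irregular) =
    injective-in-interval⇒≤ 1 k (φ ∘ nbr) (labeling ∘ nbr) labels-injective
    where
      labels-injective : Injective _≡_ _≡_ (φ ∘ nbr)
      labels-injective {i} {i′} e
        with irregular v (nbr i) v (nbr i′) (adj i) (adj i′) (cong (φ v +_) e)
      ... | inj₁ (_ , same) = nbr-inj same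
      ... | inj₂ (v≡nbr , _) = ⊥-elim (loopless G (subst (Adj G v) (sym v≡nbr) (adj i′)))

  distinctEdges⇒≤ : ∀ {D k} (edge : Fin D → Fin n × Fin n) → DistinctEdges G edge →
                    HasEdgeIrregularLabeling G k → D ≤ k + k ∸ 1
  distinctEdges⇒≤ {k = k} edge (adj , distinct) (φ , labeling , irregular) =
    injective-in-interval⇒≤ 2 (k + k) weight weight-bounds weight-injective
    where
      weight : Fin _ → ℕ
      weight e = φ (proj₁ (edge e)) + φ (proj₂ (edge e))

      weight-bounds : ∀ e → 2 ≤ weight e × weight e ≤ k + k
      weight-bounds e =
        +-mono-≤ (proj₁ (labeling (proj₁ (edge e)))) (proj₁ (labeling (proj₂ (edge e)))) ,
        +-mono-≤ (proj₂ (labeling (proj₁ (edge e)))) (proj₂ (labeling (proj₂ (edge e))))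

      weight-injective : Injective _≡_ _≡_ weight
      weight-injective {e} {e′} w = distinct e e′ (irregular _ _ _ _ (adj e) (adj e′) w)

cycleStep? : ∀ k a b → Dec (CycleStep k a b)
cycleStep? k a b = ((suc a ≟ b) ×-dec (b <? k)) ⊎-dec ((a ≟ 0) ×-dec (suc b ≟ k))

csAdj? : ∀ k m (u v : Fin (k + m)) → Dec (CSAdj k m u v)
csAdj? k m u v =
  cycleStep? k (toℕ u) (toℕ v) ⊎-dec cycleStep? k (toℕ v) (toℕ u)
  ⊎-dec ((toℕ u ≟ 0) ×-dec (k ≤? toℕ v)) ⊎-dec ((toℕ v ≟ 0) ×-dec (k ≤? toℕ u))

sameEdge? : ∀ {n} (u v x y : Fin n) → Dec (SameEdge u v x y)
sameEdge? u v x y = ((u ≟ᶠ x) ×-dec (v ≟ᶠ y)) ⊎-dec ((u ≟ᶠ y) ×-dec (v ≟ᶠ x))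

isEdgeIrregularLabeling? : ∀ j m k (φ : Fin ((3 + j) + m) → ℕ) →
                           Dec (IsEdgeIrregularLabeling (CS j m) k φ)
isEdgeIrregularLabeling? j m k φ =
  all? (λ v → (1 ≤? φ v) ×-dec (φ v ≤? k)) ×-dec
  all? λ u → all? λ v → all? λ x → all? λ y →
    csAdj? (3 + j) m u v →-dec csAdj? (3 + j) m x y →-dec
    (φ u + φ v ≟ φ x + φ y) →-dec sameEdge? u v x y

distinctEdges? : ∀ j m {D} (edge : Fin D → Fin ((3 + j) + m) × Fin ((3 + j) + m)) →
                 Dec (DistinctEdges (CS j m) edge)
distinctEdges? j m edge =
  all? (λ e → csAdj? (3 + j) m (proj₁ (edge e)) (proj₂ (edge e))) ×-dec
  all? λ e → all? λ e′ →
    sameEdge? (proj₁ (edge e)) (proj₂ (edge e)) (proj₁ (edge e′)) (proj₂ (edge e′)) →-dec (e ≟ᶠ e′)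

es-CS₆,₁ : EdgeIrregularityStrength (CS 3 1) 4
es-CS₆,₁ = (φ , from-yes (isEdgeIrregularLabeling? 3 1 4 φ)) , lower
  where
    φ : Fin 7 → ℕ
    φ = lookup (1 ∷ 1 ∷ 2 ∷ 4 ∷ 4 ∷ 3 ∷ 4 ∷ [])

    edge : Fin 7 → Fin 7 × Fin 7
    edge = lookup ((# 0 , # 1) ∷ (# 1 , # 2) ∷ (# 2 , # 3) ∷ (# 3 , # 4) ∷ (# 4 , # 5) ∷
                   (# 0 , # 5) ∷ (# 0 , # 6) ∷ [])

    lower : ∀ k → k < 4 → ¬ HasEdgeIrregularLabeling (CS 3 1) k
    lower k (s≤s k≤3) has =
      ≤⇒≯ (distinctEdges⇒≤ (CS 3 1) edge (from-yes (distinctEdges? 3 1 edge)) has)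
          (s≤s (m≤n⇒m≤1+n (∸-monoˡ-≤ 1 (+-mono-≤ k≤3 k≤3))))

es-CS₆,₂ : EdgeIrregularityStrength (CS 3 2) 5
es-CS₆,₂ = (φ , from-yes (isEdgeIrregularLabeling? 3 2 5 φ)) , lower
  where
    φ : Fin 8 → ℕ
    φ = lookup (1 ∷ 1 ∷ 2 ∷ 5 ∷ 4 ∷ 4 ∷ 3 ∷ 5 ∷ [])

    edge : Fin 8 → Fin 8 × Fin 8
    edge = lookup ((# 0 , # 1) ∷ (# 1 , # 2) ∷ (# 2 , # 3) ∷ (# 3 , # 4) ∷ (# 4 , # 5) ∷
                   (# 0 , # 5) ∷ (# 0 , # 6) ∷ (# 0 , # 7) ∷ [])

    lower : ∀ k → k < 5 → ¬ HasEdgeIrregularLabeling (CS 3 2) k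
    lower k (s≤s k≤4) has =
      ≤⇒≯ (distinctEdges⇒≤ (CS 3 2) edge (from-yes (distinctEdges? 3 2 edge)) has)
          (s≤s (∸-monoˡ-≤ 1 (+-mono-≤ k≤4 k≤4)))

label : ℕ → ℕ → ℕ
label j 0 = 5 + j
label j 1 = 1
label j 2 = 1
label j 3 = 2
label j 4 = 2
label j 5 = 3
label j 6 = 2
label j (suc (suc (suc (suc (suc (suc (suc t))))))) = 4 + t

label-bounds : ∀ j a → a < 9 + j → 1 ≤ label j a × label j a ≤ 5 + j
label-bounds j 0 _ = s≤s z≤n , ≤-refl
label-bounds j 1 _ = s≤s z≤n , s≤s z≤n
label-bounds j 2 _ = s≤s z≤n , s≤s z≤n
label-bounds j 3 _ = s≤s z≤n , s≤s (s≤s z≤n)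
label-bounds j 4 _ = s≤s z≤n , s≤s (s≤s z≤n)
label-bounds j 5 _ = s≤s z≤n , s≤s (s≤s (s≤s z≤n))
label-bounds j 6 _ = s≤s z≤n , s≤s (s≤s z≤n)
label-bounds j (suc (suc (suc (suc (suc (suc (suc t)))))))
             (s≤s (s≤s (s≤s (s≤s (s≤s (s≤s (s≤s (s≤s t≤1+j)))))))) =
  s≤s z≤n , s≤s (s≤s (s≤s (s≤s t≤1+j)))

spokeEnd : ℕ → ℕ
spokeEnd 0 = 1
spokeEnd 1 = 6
spokeEnd 2 = 5
spokeEnd (suc (suc (suc t))) = 7 + t

label-spokeEnd : ∀ j ℓ → label j (spokeEnd ℓ) ≡ suc ℓ
label-spokeEnd j 0 = refl
label-spokeEnd j 1 = refl
label-spokeEnd j 2 = refl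
label-spokeEnd j (suc (suc (suc t))) = refl

-- The edges of CS₆,ₘ with ordered endpoints: the path 1 … 5, and the edges at the hub 0
-- indexed by the label of their other end.
data CanonicalEdge : ℕ → ℕ → Set where
  rim   : ∀ p → p < 4 → CanonicalEdge (suc p) (2 + p)
  spoke : ∀ ℓ → CanonicalEdge 0 (spokeEnd ℓ)

cycleStep⇒canonical : ∀ {a b} → CycleStep 6 a b → CanonicalEdge a b
cycleStep⇒canonical {0}     (inj₁ (refl , _))                 = spoke 0
cycleStep⇒canonical {suc p} (inj₁ (refl , s≤s (s≤s p<4)))    = rim p p<4
cycleStep⇒canonical         (inj₂ (refl , refl))              = spoke 2

leaf⇒canonical : ∀ {b} → 6 ≤ b → CanonicalEdge 0 b
leaf⇒canonical (s≤s (s≤s (s≤s (s≤s (s≤s (s≤s (z≤n {0}))))))) = spoke 1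
leaf⇒canonical (s≤s (s≤s (s≤s (s≤s (s≤s (s≤s (z≤n {suc t}))))))) = spoke (3 + t)

csAdj⇒canonical : ∀ m (u v : Fin (6 + m)) → CSAdj 6 m u v →
                  CanonicalEdge (toℕ u) (toℕ v) ⊎ CanonicalEdge (toℕ v) (toℕ u)
csAdj⇒canonical m u v (inj₁ step) = inj₁ (cycleStep⇒canonical step)
csAdj⇒canonical m u v (inj₂ (inj₁ step)) = inj₂ (cycleStep⇒canonical step)
csAdj⇒canonical m u v (inj₂ (inj₂ (inj₁ (u≡0 , 6≤v)))) =
  inj₁ (subst (λ a → CanonicalEdge a (toℕ v)) (sym u≡0) (leaf⇒canonical 6≤v))
csAdj⇒canonical m u v (inj₂ (inj₂ (inj₂ (v≡0 , 6≤u)))) =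
  inj₂ (subst (λ a → CanonicalEdge a (toℕ u)) (sym v≡0) (leaf⇒canonical 6≤u))

edgeWeight : ℕ → ∀ {p q} → CanonicalEdge p q → ℕ
edgeWeight j (rim p _) = 2 + p
edgeWeight j (spoke ℓ) = 5 + j + suc ℓ

label-edgeWeight : ∀ j {p q} (c : CanonicalEdge p q) → label j p + label j q ≡ edgeWeight j c
label-edgeWeight j (rim 0 _) = refl
label-edgeWeight j (rim 1 _) = refl
label-edgeWeight j (rim 2 _) = refl
label-edgeWeight j (rim 3 _) = refl
label-edgeWeight j (rim (suc (suc (suc (suc _)))) (s≤s (s≤s (s≤s (s≤s ())))))
label-edgeWeight j (spoke ℓ) = cong (5 + j +_) (label-spokeEnd j ℓ)

rim<spoke : ∀ j p ℓ → p < 4 → 2 + p < 5 + j + suc ℓ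
rim<spoke j p ℓ p<4 = ≤-<-trans (s≤s p<4) (+-monoʳ-< 5 (≤-trans (s≤s z≤n) (m≤n+m (suc ℓ) j)))

edgeWeight-injective : ∀ j {p q r s} (c : CanonicalEdge p q) (d : CanonicalEdge r s) →
                       edgeWeight j c ≡ edgeWeight j d → p ≡ r × q ≡ s
edgeWeight-injective j (rim p _) (rim r _) w = cong suc p≡r , cong (2 +_) p≡r
  where p≡r : p ≡ r
        p≡r = +-cancelˡ-≡ 2 p r w
edgeWeight-injective j (rim p p<4) (spoke ℓ) w = ⊥-elim (<⇒≢ (rim<spoke j p ℓ p<4) w)
edgeWeight-injective j (spoke ℓ) (rim r r<4) w = ⊥-elim (<⇒≢ (rim<spoke j r ℓ r<4) (sym w))
edgeWeight-injective j (spoke ℓ) (spoke ℓ′) w =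
  refl , cong spokeEnd (suc-injective (+-cancelˡ-≡ (5 + j) (suc ℓ) (suc ℓ′) w))

label-determines-edge : ∀ j {p q r s} (c : CanonicalEdge p q) (d : CanonicalEdge r s) →
                        label j p + label j q ≡ label j r + label j s → p ≡ r × q ≡ s
label-determines-edge j c d w =
  edgeWeight-injective j c d (trans (sym (label-edgeWeight j c)) (trans w (label-edgeWeight j d)))

label-irregular : ∀ j {p q r s} →
                  CanonicalEdge p q ⊎ CanonicalEdge q p → CanonicalEdge r s ⊎ CanonicalEdge s r →
                  label j p + label j q ≡ label j r + label j s → (p ≡ r × q ≡ s) ⊎ (p ≡ s × q ≡ r)
label-irregular j {p} {q} {r} {s} (inj₁ c) (inj₁ d) w = inj₁ (label-determines-edge j c d w)
label-irregular j {p} {q} {r} {s} (inj₁ c) (inj₂ d) w =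
  inj₂ (label-determines-edge j c d (trans w (+-comm (label j r) (label j s))))
label-irregular j {p} {q} {r} {s} (inj₂ c) (inj₁ d) w =
  inj₂ (swap (label-determines-edge j c d (trans (+-comm (label j q) (label j p)) w)))
label-irregular j {p} {q} {r} {s} (inj₂ c) (inj₂ d) w =
  inj₁ (swap (label-determines-edge j c d
    (trans (+-comm (label j q) (label j p)) (trans w (+-comm (label j r) (label j s))))))

label-edgeIrregular : ∀ j → IsEdgeIrregularLabeling (CS 3 (3 + j)) (5 + j) (label j ∘ toℕ)
label-edgeIrregular j = (λ v → label-bounds j (toℕ v) (toℕ<n v)) , irregular
  where
    irregular : ∀ u v x y → CSAdj 6 (3 + j) u v → CSAdj 6 (3 + j) x y →
                label j (toℕ u) + label j (toℕ v) ≡ label j (toℕ x) + label j (toℕ y) →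
                SameEdge u v x y
    irregular u v x y uv xy w =
      ⊎-map (×-map toℕ-injective toℕ-injective) (×-map toℕ-injective toℕ-injective)
            (label-irregular j (csAdj⇒canonical (3 + j) u v uv) (csAdj⇒canonical (3 + j) x y xy) w)

hubNeighbour : ∀ j → Fin (5 + j) → Fin (9 + j)
hubNeighbour j fzero = # 1
hubNeighbour j (fsuc fzero) = # 5
hubNeighbour j (fsuc (fsuc t)) = 6 ↑ʳ t

hubNeighbour-adjacent : ∀ j i → CSAdj 6 (3 + j) fzero (hubNeighbour j i)
hubNeighbour-adjacent j fzero = inj₁ (inj₁ (refl , s≤s (s≤s z≤n)))
hubNeighbour-adjacent j (fsuc fzero) = inj₁ (inj₂ (refl , refl))
hubNeighbour-adjacent j (fsuc (fsuc t)) = inj₂ (inj₂ (inj₁ (refl , m≤m+n 6 (toℕ t))))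

hubNeighbour-injective : ∀ j → Injective _≡_ _≡_ (hubNeighbour j)
hubNeighbour-injective j {fzero}          {fzero}           _ = refl
hubNeighbour-injective j {fsuc fzero}     {fsuc fzero}      _ = refl
hubNeighbour-injective j {fsuc (fsuc t)}  {fsuc (fsuc t′)}  e = cong (fsuc ∘ fsuc) (↑ʳ-injective 6 t t′ e)
hubNeighbour-injective j {fzero}          {fsuc fzero}      ()
hubNeighbour-injective j {fzero}          {fsuc (fsuc _)}   ()
hubNeighbour-injective j {fsuc fzero}     {fzero}           ()
hubNeighbour-injective j {fsuc fzero}     {fsuc (fsuc _)}   ()
hubNeighbour-injective j {fsuc (fsuc _)}  {fzero}           ()
hubNeighbour-injective j {fsuc (fsuc _)}  {fsuc fzero}      ()

es-CS₆,₃₊ⱼ : ∀ j → EdgeIrregularityStrength (CS 3 (3 + j)) (5 + j)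
es-CS₆,₃₊ⱼ j = (label j ∘ toℕ , label-edgeIrregular j) , lower
  where
    lower : ∀ k → k < 5 + j → ¬ HasEdgeIrregularLabeling (CS 3 (3 + j)) k
    lower k k<5+j has = ≤⇒≯ (distinctNeighbours⇒≤ (CS 3 (3 + j)) fzero (hubNeighbour j)
                                (hubNeighbour-adjacent j) (hubNeighbour-injective j) has) k<5+j

theorem3p5 : ∀ (n : ℕ) → 7 ≤ n →
    ((n ≡ 7 ⊎ n ≡ 8) → EdgeIrregularityStrength (CS 3 (n ∸ 6)) (n ∸ 3))
    × (9 ≤ n → EdgeIrregularityStrength (CS 3 (n ∸ 6)) (n ∸ 4))
theorem3p5 n 7≤n with m≤n⇒∃[o]m+o≡n 7≤n
... | 0 , refl = (λ _ → es-CS₆,₁) , ⊥-elim ∘ from-no (9 ≤? 7)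
... | 1 , refl = (λ _ → es-CS₆,₂) , ⊥-elim ∘ from-no (9 ≤? 8)
... | suc (suc j) , refl = (λ { (inj₁ ()) ; (inj₂ ()) }) , λ _ → es-CS₆,₃₊ⱼ j
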